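{- Let $k,\lambda$ be positive integers, let $\mu=k-\lambda$, and let $\mathcal{H}$ be a $\lambda$-intersecting $k$-graph with $m \geq 20\mu$ edges. Then for every vertex $v\in V(\mathcal{H})$, either $d(v) \leq 1.1 \mu$ or $d(v) \geq m - 1.1 \mu$.
   Context: A $k$-graph is a $k$-uniform hypergraph (edges are distinct $k$-element sets). A hypergraph is $\lambda$-intersecting if every pair of distinct edges shares exactly $\lambda$ vertices. $d(v)$ denotes the degree of $v$, the number of edges containing $v$. -}

module Defs where

open import Data.Nat using (ℕ; _*_; _+_; _≤_)
open import Data.Fin using (Fin)
open import Data.Fin.Subset using (Subset; _∩_; ∣_∣)
open import Data.Fin.Subset.Properties using (_∈?_)
open import Data.List using (List; length; filter)
open import Data.List.Relation.Unary.All using (All)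
open import Data.List.Relation.Unary.AllPairs using (AllPairs)
open import Data.List.Relation.Unary.Unique.Propositional using (Unique)
open import Data.Product using (_×_)
open import Relation.Binary.PropositionalEquality using (_≡_)

record Hypergraph (n : ℕ) : Set where
  constructor hypergraph
  field
    edges    : List (Subset n)
    distinct : Unique edges

open Hypergraph public

numEdges : ∀ {n} → Hypergraph n → ℕ
numEdges H = length (edges H)

IsUniform : ∀ {n} → ℕ → Hypergraph n → Set
IsUniform k H = All (λ e → ∣ e ∣ ≡ k) (edges H)

-- λ-intersecting: every pair of distinct edges shares exactly λ vertices
-- (edges are distinct, so this ranges over pairs at distinct list positions)
IsIntersecting : ∀ {n} → ℕ → Hypergraph n → Set
IsIntersecting l H = AllPairs (λ e f → ∣ e ∩ f ∣ ≡ l) (edges H)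

degree : ∀ {n} → Hypergraph n → Fin n → ℕ
degree H v = length (filter (v ∈?_) (edges H))

{-# OPTIONS --safe #-}
module Submission where

-- Split the m edges at v into the d edges through v and the b edges avoiding it, with
-- vertex-degree vectors D⁺, D⁻ ∈ ℕⁿ. Counting incidences, ⟨D⁺, D⁻⟩ = Σ ∣e ∩ f∣ over cross
-- pairs = dbλ, ⟨D⁺, D⁺⟩ = dk + d(d − 1)λ and ⟨D⁻, D⁻⟩ = bk + b(b − 1)λ. As D⁻ vanishes at v
-- while D⁺ equals d there, ‖b D⁺ − d D⁻‖² ≥ (bd)², which expands to bd ≤ (b + d)(k − λ) = mμ.
-- For b + d = m ≥ 20μ this forces min(b, d) ≤ 1.1μ.

open import Defs
open import Data.Bool using (true; false; if_then_else_)
open import Data.Empty using (⊥-elim)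
open import Data.Fin using (Fin; zero; suc)
open import Data.Fin.Subset using (Subset; _∩_; ∣_∣)
open import Data.Fin.Subset.Properties using (_∈?_; ∩-idem; ∩-comm)
open import Data.List using (List; []; _∷_; length; filter)
open import Data.List.Properties using (filter-all; filter-none)
open import Data.List.Relation.Unary.All as All using (All; []; _∷_)
import Data.List.Relation.Unary.All.Properties as All
open import Data.List.Relation.Unary.AllPairs using (AllPairs; []; _∷_)
import Data.List.Relation.Unary.AllPairs.Properties as AllPairs
open import Data.Nat using (ℕ; zero; suc; _+_; _*_; _∸_; _≤_; _<_; _≤?_; z≤n; s≤s; NonZero)
open import Data.Nat.Properties
open import Algebra.Properties.CommutativeSemigroup +-commutativeSemigroup
  using () renaming (interchange to +-interchange)
open import Data.Nat.Tactic.RingSolver using (solve-∀)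
open import Data.Product using (_,_)
open import Data.Sum using (_⊎_; inj₁; inj₂; [_,_]′; map₂)
open import Data.Vec using (Vec; []; _∷_; lookup; replicate; zipWith; sum)
import Data.Vec as Vec
open import Data.Vec.Properties using (lookup-zipWith; lookup-replicate)
open import Level using (Level)
open import Relation.Binary.Core using (Rel)
open import Relation.Binary.Definitions using (Symmetric)
open import Relation.Binary.PropositionalEquality using (_≡_; refl; sym; trans; cong; cong₂; subst; subst₂; module ≡-Reasoning)
open import Relation.Nullary using (yes; no; does)
open import Relation.Unary using (Pred; Decidable)
open import Relation.Unary.Properties using (∁?)

private
  variable
    a p r : Level
    A : Set a
    n k l : ℕ

module _ {P : Pred A p} (P? : Decidable P) where

  length-filter+length-filter-∁ : ∀ xs → length (filter P? xs) + length (filter (∁? P?) xs) ≡ length xs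
  length-filter+length-filter-∁ [] = refl
  length-filter+length-filter-∁ (x ∷ xs) with P? x
  ... | yes _ = cong suc (length-filter+length-filter-∁ xs)
  ... | no _  = trans (+-suc _ _) (cong suc (length-filter+length-filter-∁ xs))

  allPairs⇒all-across-filter : {R : Rel A r} → Symmetric R → ∀ {xs} → AllPairs R xs →
    All (λ x → All (R x) (filter (∁? P?) xs)) (filter P? xs)
  allPairs⇒all-across-filter R-sym {[]} [] = []
  allPairs⇒all-across-filter R-sym {x ∷ xs} (Rx ∷ Rxs) with P? x
  ... | yes _ = All.filter⁺ (∁? P?) Rx ∷ allPairs⇒all-across-filter R-sym Rxs
  ... | no _  = All.zipWith (λ (Ryx , Ry) → Ryx ∷ Ry)
                  (All.filter⁺ P? (All.map R-sym Rx) , allPairs⇒all-across-filter R-sym Rxs)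

2*m*n≤m*m+n*n : ∀ m n → 2 * m * n ≤ m * m + n * n
2*m*n≤m*m+n*n m n = [ ordered , swapped ]′ (≤-total m n)
  where
  ordered : ∀ {x y} → x ≤ y → 2 * x * y ≤ x * x + y * y
  ordered {x} x≤y = let o , x+o≡y = m≤n⇒∃[o]m+o≡n x≤y in
    subst (λ y → 2 * x * y ≤ x * x + y * y) x+o≡y
      (subst (2 * x * (x + o) ≤_) (square-offset x o) (m≤m+n _ (o * o)))
    where
    square-offset : ∀ x o → 2 * x * (x + o) + o * o ≡ x * x + (x + o) * (x + o)
    square-offset = solve-∀
  swapped : n ≤ m → 2 * m * n ≤ m * m + n * n
  swapped n≤m = subst₂ _≤_ (swap-factors m n) (+-comm (n * n) (m * m)) (ordered n≤m)
    where
    swap-factors : ∀ m n → 2 * n * m ≡ 2 * m * n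
    swap-factors = solve-∀

c*[m+n]≤m*n+c*c : ∀ {c m n} → c ≤ m → c ≤ n → c * (m + n) ≤ m * n + c * c
c*[m+n]≤m*n+c*c {c} c≤m c≤n =
  let i , c+i≡m = m≤n⇒∃[o]m+o≡n c≤m
      j , c+j≡n = m≤n⇒∃[o]m+o≡n c≤n
  in subst₂ (λ m n → c * (m + n) ≤ m * n + c * c) c+i≡m c+j≡n
       (subst (c * (c + i + (c + j)) ≤_) (expand c i j) (m≤m+n _ (i * j)))
  where
  expand : ∀ c i j → c * (c + i + (c + j)) + i * j ≡ (c + i) * (c + j) + c * c
  expand = solve-∀

m*m+m*n≤m*o⇒m≤o∸n : ∀ m n o → m * m + m * n ≤ m * o → m ≤ o ∸ n
m*m+m*n≤m*o⇒m≤o∸n zero    n o _ = z≤n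
m*m+m*n≤m*o⇒m≤o∸n (suc m) n o h =
  m+n≤o⇒m≤o∸n (suc m) (*-cancelˡ-≤ (suc m) (subst (_≤ suc m * o) (sym (*-distribˡ-+ (suc m) (suc m) n)) h))

d*b≤[d+b]*[k∸l] : ∀ d b k l {g⁺ g⁻} → g⁺ + d * l ≡ d * k + d * d * l → g⁻ + b * l ≡ b * k + b * b * l →
  b * b * (d * d) + 2 * b * d * (d * b * l) ≤ b * b * g⁺ + d * d * g⁻ → d * b ≤ (d + b) * (k ∸ l)
d*b≤[d+b]*[k∸l] d b k l {g⁺} {g⁻} gram⁺ gram⁻ cauchy = begin
  d * b                ≤⟨ m*m+m*n≤m*o⇒m≤o∸n (d * b) (s * l) (s * k) cancelled ⟩
  s * k ∸ s * l        ≡⟨ *-distribˡ-∸ s k l ⟨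
  s * (k ∸ l)          ∎
  where
  open ≤-Reasoning
  s = d + b
  cancelled : d * b * (d * b) + d * b * (s * l) ≤ d * b * (s * k)
  cancelled = +-cancelʳ-≤ (2 * (d * b) * (d * b) * l) _ _ (begin
    d * b * (d * b) + d * b * (s * l) + 2 * (d * b) * (d * b) * l
      ≡⟨ expand d b l ⟩
    b * b * (d * d) + 2 * b * d * (d * b * l) + (b * b * (d * l) + d * d * (b * l))
      ≤⟨ +-monoˡ-≤ _ cauchy ⟩
    b * b * g⁺ + d * d * g⁻ + (b * b * (d * l) + d * d * (b * l))
      ≡⟨ distribute b d g⁺ g⁻ l ⟩
    b * b * (g⁺ + d * l) + d * d * (g⁻ + b * l)
      ≡⟨ cong₂ (λ t r → b * b * t + d * d * r) gram⁺ gram⁻ ⟩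
    b * b * (d * k + d * d * l) + d * d * (b * k + b * b * l)
      ≡⟨ collect d b k l ⟩
    d * b * (s * k) + 2 * (d * b) * (d * b) * l  ∎)
    where
    expand : ∀ d b l → d * b * (d * b) + d * b * ((d + b) * l) + 2 * (d * b) * (d * b) * l
                       ≡ b * b * (d * d) + 2 * b * d * (d * b * l) + (b * b * (d * l) + d * d * (b * l))
    expand = solve-∀
    distribute : ∀ b d t r l → b * b * t + d * d * r + (b * b * (d * l) + d * d * (b * l))
                               ≡ b * b * (t + d * l) + d * d * (r + b * l)
    distribute = solve-∀
    collect : ∀ d b k l → b * b * (d * k + d * d * l) + d * d * (b * k + b * b * l)
                          ≡ d * b * ((d + b) * k) + 2 * (d * b) * (d * b) * l
    collect = solve-∀

-- If both parts exceed 1.1μ, put c = 11μ + 1 ≤ 10d, 10b: convexity gives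
-- c · 10(d + b) ≤ 100 d b + c², and 100 d b ≤ 10μ · 10(d + b), leaving
-- (μ + 1) · 10(d + b) ≤ c², which is too small for d + b ≥ 20μ.
unbalanced-split : ∀ μ d b → 20 * μ ≤ d + b → d * b ≤ (d + b) * μ →
                   10 * d ≤ 11 * μ ⊎ 10 * b ≤ 11 * μ
unbalanced-split μ d b 20μ≤d+b db≤[d+b]μ with 10 * d ≤? 11 * μ | 10 * b ≤? 11 * μ
... | yes small | _         = inj₁ small
... | no _      | yes small = inj₂ small
... | no large₁ | no large₂ = ⊥-elim (<⇒≱ c*c<[1+μ]*s [1+μ]*s≤c*c)
  where
  open ≤-Reasoning
  c = suc (11 * μ)
  x = 10 * d
  y = 10 * b
  s = x + y
  200μ≤s : 200 * μ ≤ s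
  200μ≤s = subst₂ _≤_ (sym (*-assoc 10 20 μ)) (*-distribˡ-+ 10 d b) (*-monoʳ-≤ 10 20μ≤d+b)
  x*y≤10μ*s : x * y ≤ 10 * μ * s
  x*y≤10μ*s = begin
    x * y                 ≡⟨ scale-product d b ⟩
    100 * (d * b)         ≤⟨ *-monoʳ-≤ 100 db≤[d+b]μ ⟩
    100 * ((d + b) * μ)   ≡⟨ scale-bound d b μ ⟩
    10 * μ * s            ∎
    where
    scale-product : ∀ d b → 10 * d * (10 * b) ≡ 100 * (d * b)
    scale-product = solve-∀
    scale-bound : ∀ d b μ → 100 * ((d + b) * μ) ≡ 10 * μ * (10 * d + 10 * b)
    scale-bound = solve-∀
  [1+μ]*s≤c*c : suc μ * s ≤ c * c
  [1+μ]*s≤c*c = +-cancelˡ-≤ (10 * μ * s) _ _ (begin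
    10 * μ * s + suc μ * s  ≡⟨ split-c μ s ⟩
    c * s                   ≤⟨ c*[m+n]≤m*n+c*c (≰⇒> large₁) (≰⇒> large₂) ⟩
    x * y + c * c           ≤⟨ +-monoˡ-≤ (c * c) x*y≤10μ*s ⟩
    10 * μ * s + c * c      ∎)
    where
    split-c : ∀ μ s → 10 * μ * s + suc μ * s ≡ suc (11 * μ) * s
    split-c = solve-∀
  c*c<[1+μ]*s : c * c < suc μ * s
  c*c<[1+μ]*s = begin-strict
    c * c                         <⟨ s≤s (m≤m+n (c * c) (79 * (μ * μ))) ⟩
    suc (c * c + 79 * (μ * μ))    ≡⟨ expand-c μ ⟩
    μ * (200 * μ) + (c + c)       ≤⟨ +-mono-≤ (*-monoʳ-≤ μ 200μ≤s) (+-mono-≤ (≰⇒> large₁) (≰⇒> large₂)) ⟩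
    μ * s + s                     ≡⟨ +-comm (μ * s) s ⟩
    suc μ * s                     ∎
    where
    expand-c : ∀ μ → suc (suc (11 * μ) * suc (11 * μ) + 79 * (μ * μ)) ≡ μ * (200 * μ) + (suc (11 * μ) + suc (11 * μ))
    expand-c = solve-∀

infixl 6 _+ᵛ_
infix  7 _·_

_+ᵛ_ : Vec ℕ n → Vec ℕ n → Vec ℕ n
_+ᵛ_ = zipWith _+_

_·_ : Vec ℕ n → Vec ℕ n → ℕ
u · w = sum (zipWith _*_ u w)

·-comm : (u w : Vec ℕ n) → u · w ≡ w · u
·-comm []      []      = refl
·-comm (x ∷ u) (y ∷ w) = cong₂ _+_ (*-comm x y) (·-comm u w)

·-zeroʳ : (u : Vec ℕ n) → u · replicate n 0 ≡ 0
·-zeroʳ []      = refl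
·-zeroʳ (x ∷ u) = cong₂ _+_ (*-zeroʳ x) (·-zeroʳ u)

·-zeroˡ : (u : Vec ℕ n) → replicate n 0 · u ≡ 0
·-zeroˡ u = trans (·-comm _ u) (·-zeroʳ u)

·-distribˡ-+ᵛ : (u v w : Vec ℕ n) → u · (v +ᵛ w) ≡ u · v + u · w
·-distribˡ-+ᵛ []      []      []      = refl
·-distribˡ-+ᵛ (x ∷ u) (y ∷ v) (z ∷ w) = begin
  x * (y + z) + u · (v +ᵛ w)       ≡⟨ cong₂ _+_ (*-distribˡ-+ x y z) (·-distribˡ-+ᵛ u v w) ⟩
  x * y + x * z + (u · v + u · w)  ≡⟨ +-interchange (x * y) (x * z) (u · v) (u · w) ⟩
  x * y + u · v + (x * z + u · w)  ∎
  where open ≡-Reasoning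

·-distribʳ-+ᵛ : (u v w : Vec ℕ n) → (u +ᵛ v) · w ≡ u · w + v · w
·-distribʳ-+ᵛ u v w = begin
  (u +ᵛ v) · w   ≡⟨ ·-comm (u +ᵛ v) w ⟩
  w · (u +ᵛ v)   ≡⟨ ·-distribˡ-+ᵛ w u v ⟩
  w · u + w · v  ≡⟨ cong₂ _+_ (·-comm w u) (·-comm w v) ⟩
  u · w + v · w  ∎
  where open ≡-Reasoning

·-square-+ᵛ : (u w : Vec ℕ n) → (u +ᵛ w) · (u +ᵛ w) ≡ u · u + 2 * (u · w) + w · w
·-square-+ᵛ u w = begin
  (u +ᵛ w) · (u +ᵛ w)              ≡⟨ ·-distribʳ-+ᵛ u w (u +ᵛ w) ⟩
  u · (u +ᵛ w) + w · (u +ᵛ w)      ≡⟨ cong₂ _+_ (·-distribˡ-+ᵛ u u w) (·-distribˡ-+ᵛ w u w) ⟩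
  u · u + u · w + (w · u + w · w)  ≡⟨ cong (λ c → u · u + u · w + (c + w · w)) (·-comm w u) ⟩
  u · u + u · w + (u · w + w · w)  ≡⟨ collect (u · u) (u · w) (w · w) ⟩
  u · u + 2 * (u · w) + w · w      ∎
  where
  open ≡-Reasoning
  collect : ∀ a c b → a + c + (c + b) ≡ a + 2 * c + b
  collect = solve-∀

·-cauchy-step : ∀ p q x y {a s t r} → a + 2 * p * q * s ≤ p * p * t + q * q * r →
  a + 2 * p * q * (x * y + s) ≤ p * p * (x * x + t) + q * q * (y * y + r)
·-cauchy-step p q x y {a} {s} {t} {r} ih = begin
  a + 2 * p * q * (x * y + s)                                 ≡⟨ split-cross p q x y a s ⟩
  2 * (p * x) * (q * y) + (a + 2 * p * q * s)                 ≤⟨ +-mono-≤ (2*m*n≤m*m+n*n (p * x) (q * y)) ih ⟩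
  p * x * (p * x) + q * y * (q * y) + (p * p * t + q * q * r) ≡⟨ merge-squares p q x y t r ⟩
  p * p * (x * x + t) + q * q * (y * y + r)                   ∎
  where
  open ≤-Reasoning
  split-cross : ∀ p q x y a s → a + 2 * p * q * (x * y + s) ≡ 2 * (p * x) * (q * y) + (a + 2 * p * q * s)
  split-cross = solve-∀
  merge-squares : ∀ p q x y t r → p * x * (p * x) + q * y * (q * y) + (p * p * t + q * q * r)
                                  ≡ p * p * (x * x + t) + q * q * (y * y + r)
  merge-squares = solve-∀

·-cauchy : ∀ p q (u w : Vec ℕ n) → 2 * p * q * (u · w) ≤ p * p * (u · u) + q * q * (w · w)
·-cauchy p q []      []      = subst (_≤ p * p * 0 + q * q * 0) (sym (*-zeroʳ (2 * p * q))) z≤n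
·-cauchy p q (x ∷ u) (y ∷ w) = ·-cauchy-step p q x y (·-cauchy p q u w)

-- The slack in ·-cauchy is Σᵢ (p uᵢ − q wᵢ)², which is at least the term (p uᵢ)² at a zero of w.
·-cauchy-at-zero : ∀ p q (u w : Vec ℕ n) (i : Fin n) → lookup w i ≡ 0 →
  p * p * (lookup u i * lookup u i) + 2 * p * q * (u · w) ≤ p * p * (u · u) + q * q * (w · w)
·-cauchy-at-zero p q (x ∷ u) (.0 ∷ w) zero refl = begin
  p * p * (x * x) + 2 * p * q * (x * 0 + u · w)         ≡⟨ drop-cross p q x (u · w) ⟩
  p * p * (x * x) + 2 * p * q * (u · w)                 ≤⟨ +-monoʳ-≤ (p * p * (x * x)) (·-cauchy p q u w) ⟩
  p * p * (x * x) + (p * p * (u · u) + q * q * (w · w)) ≡⟨ collect p q x (u · u) (w · w) ⟩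
  p * p * (x * x + u · u) + q * q * (w · w)             ∎
  where
  open ≤-Reasoning
  drop-cross : ∀ p q x s → p * p * (x * x) + 2 * p * q * (x * 0 + s) ≡ p * p * (x * x) + 2 * p * q * s
  drop-cross = solve-∀
  collect : ∀ p q x s t → p * p * (x * x) + (p * p * s + q * q * t) ≡ p * p * (x * x + s) + q * q * t
  collect = solve-∀
·-cauchy-at-zero p q (x ∷ u) (y ∷ w) (suc i) wᵢ≡0 =
  ·-cauchy-step p q x y (·-cauchy-at-zero p q u w i wᵢ≡0)

indicator : Subset n → Vec ℕ n
indicator = Vec.map (λ b → if b then 1 else 0)

degrees : List (Subset n) → Vec ℕ n
degrees []       = replicate _ 0
degrees (e ∷ es) = indicator e +ᵛ degrees es

∣∩∣≡indicator·indicator : (e f : Subset n) → ∣ e ∩ f ∣ ≡ indicator e · indicator f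
∣∩∣≡indicator·indicator []          []          = refl
∣∩∣≡indicator·indicator (false ∷ e) (_ ∷ f)     = ∣∩∣≡indicator·indicator e f
∣∩∣≡indicator·indicator (true ∷ e)  (false ∷ f) = ∣∩∣≡indicator·indicator e f
∣∩∣≡indicator·indicator (true ∷ e)  (true ∷ f)  = cong suc (∣∩∣≡indicator·indicator e f)

lookup-indicator : (v : Fin n) (e : Subset n) → lookup (indicator e) v ≡ (if does (v ∈? e) then 1 else 0)
lookup-indicator zero    (true ∷ e)  = refl
lookup-indicator zero    (false ∷ e) = refl
lookup-indicator (suc v) (_ ∷ e)     = lookup-indicator v e

containing avoiding : Fin n → List (Subset n) → List (Subset n)
containing v = filter (v ∈?_)
avoiding   v = filter (∁? (v ∈?_))

lookup-degrees : (v : Fin n) (es : List (Subset n)) → lookup (degrees es) v ≡ length (containing v es)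
lookup-degrees v []       = lookup-replicate v 0
lookup-degrees v (e ∷ es)
  rewrite lookup-zipWith _+_ v (indicator e) (degrees es) | lookup-indicator v e | lookup-degrees v es
  with does (v ∈? e)
... | true  = refl
... | false = refl

indicator·degrees : (e : Subset n) {fs : List (Subset n)} → All (λ f → ∣ e ∩ f ∣ ≡ l) fs →
  indicator e · degrees fs ≡ length fs * l
indicator·degrees e []                 = ·-zeroʳ (indicator e)
indicator·degrees {l = l} e {f ∷ fs} (e∩f ∷ e∩fs) = begin
  indicator e · (indicator f +ᵛ degrees fs)
    ≡⟨ ·-distribˡ-+ᵛ (indicator e) (indicator f) (degrees fs) ⟩
  indicator e · indicator f + indicator e · degrees fs
    ≡⟨ cong₂ _+_ (trans (sym (∣∩∣≡indicator·indicator e f)) e∩f) (indicator·degrees e e∩fs) ⟩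
  l + length fs * l
    ∎
  where open ≡-Reasoning

degrees·degrees-across : {es fs : List (Subset n)} → All (λ e → All (λ f → ∣ e ∩ f ∣ ≡ l) fs) es →
  degrees es · degrees fs ≡ length es * length fs * l
degrees·degrees-across {fs = fs} [] = ·-zeroˡ (degrees fs)
degrees·degrees-across {l = l} {e ∷ es} {fs} (e∩fs ∷ es∩fs) = begin
  (indicator e +ᵛ degrees es) · degrees fs            ≡⟨ ·-distribʳ-+ᵛ (indicator e) (degrees es) (degrees fs) ⟩
  indicator e · degrees fs + degrees es · degrees fs  ≡⟨ cong₂ _+_ (indicator·degrees e e∩fs) (degrees·degrees-across es∩fs) ⟩
  length fs * l + length es * length fs * l           ≡⟨ *-distribʳ-+ l (length fs) (length es * length fs) ⟨
  (length fs + length es * length fs) * l             ∎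
  where open ≡-Reasoning

degrees·degrees-within : {es : List (Subset n)} → All (λ e → ∣ e ∣ ≡ k) es → AllPairs (λ e f → ∣ e ∩ f ∣ ≡ l) es →
  degrees es · degrees es + length es * l ≡ length es * k + length es * length es * l
degrees·degrees-within {n = n} {es = []} [] [] = trans (+-identityʳ _) (·-zeroʳ (replicate n 0))
degrees·degrees-within {k = k} {l = l} {e ∷ es} (∣e∣≡k ∷ ∣es∣≡k) (e∩es ∷ es∩es) = begin
  (e⁺ +ᵛ D) · (e⁺ +ᵛ D) + suc L * l            ≡⟨ cong (_+ suc L * l) (·-square-+ᵛ e⁺ D) ⟩
  e⁺ · e⁺ + 2 * (e⁺ · D) + D · D + suc L * l    ≡⟨ cong₂ (λ a c → a + 2 * c + D · D + suc L * l) e⁺·e⁺≡k e⁺·D≡Ll ⟩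
  k + 2 * (L * l) + D · D + suc L * l           ≡⟨ regroup k l L (D · D) ⟩
  k + 2 * (L * l) + l + (D · D + L * l)         ≡⟨ cong (k + 2 * (L * l) + l +_) (degrees·degrees-within ∣es∣≡k es∩es) ⟩
  k + 2 * (L * l) + l + (L * k + L * L * l)     ≡⟨ collect k l L ⟩
  suc L * k + suc L * suc L * l                 ∎
  where
  open ≡-Reasoning
  e⁺ = indicator e
  D = degrees es
  L = length es
  e⁺·e⁺≡k : e⁺ · e⁺ ≡ k
  e⁺·e⁺≡k = trans (sym (∣∩∣≡indicator·indicator e e)) (trans (cong ∣_∣ (∩-idem e)) ∣e∣≡k)
  e⁺·D≡Ll : e⁺ · D ≡ L * l
  e⁺·D≡Ll = indicator·degrees e e∩es
  regroup : ∀ k l L s → k + 2 * (L * l) + s + suc L * l ≡ k + 2 * (L * l) + l + (s + L * l)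
  regroup = solve-∀
  collect : ∀ k l L → k + 2 * (L * l) + l + (L * k + L * L * l) ≡ suc L * k + suc L * suc L * l
  collect = solve-∀

containing*avoiding≤length*[k∸l] : (v : Fin n) {es : List (Subset n)} →
  All (λ e → ∣ e ∣ ≡ k) es → AllPairs (λ e f → ∣ e ∩ f ∣ ≡ l) es →
  length (containing v es) * length (avoiding v es) ≤ length es * (k ∸ l)
containing*avoiding≤length*[k∸l] {k = k} {l = l} v {es} uniform intersecting =
  subst (d * b ≤_) (cong (_* (k ∸ l)) (length-filter+length-filter-∁ (v ∈?_) es))
    (d*b≤[d+b]*[k∸l] d b k l gram-in gram-out
      (subst₂ (λ x c → b * b * (x * x) + 2 * b * d * c ≤ b * b * (D⁺ · D⁺) + d * d * (D⁻ · D⁻))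
              v-in-all gram-cross (·-cauchy-at-zero b d D⁺ D⁻ v v-in-none)))
  where
  In = containing v es
  Out = avoiding v es
  d = length In
  b = length Out
  D⁺ = degrees In
  D⁻ = degrees Out
  v-in-all : lookup D⁺ v ≡ d
  v-in-all = trans (lookup-degrees v In) (cong length (filter-all (v ∈?_) (All.all-filter (v ∈?_) es)))
  v-in-none : lookup D⁻ v ≡ 0
  v-in-none = trans (lookup-degrees v Out) (cong length (filter-none (v ∈?_) (All.all-filter (∁? (v ∈?_)) es)))
  gram-in : D⁺ · D⁺ + d * l ≡ d * k + d * d * l
  gram-in = degrees·degrees-within (All.filter⁺ (v ∈?_) uniform) (AllPairs.filter⁺ (v ∈?_) intersecting)
  gram-out : D⁻ · D⁻ + b * l ≡ b * k + b * b * l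
  gram-out = degrees·degrees-within (All.filter⁺ (∁? (v ∈?_)) uniform) (AllPairs.filter⁺ (∁? (v ∈?_)) intersecting)
  gram-cross : D⁺ · D⁻ ≡ d * b * l
  gram-cross = degrees·degrees-across (allPairs⇒all-across-filter (v ∈?_) (λ {e} {f} → ∩-sym e f) intersecting)
    where
    ∩-sym : ∀ e f → ∣ e ∩ f ∣ ≡ l → ∣ f ∩ e ∣ ≡ l
    ∩-sym e f = trans (cong ∣_∣ (∩-comm f e))

lemma4p4 : (k l n : ℕ) → .{{NonZero k}} → .{{NonZero l}} → (H : Hypergraph n) →
    IsUniform k H → IsIntersecting l H → 20 * (k ∸ l) ≤ numEdges H →
    (v : Fin n) →
    (10 * degree H v ≤ 11 * (k ∸ l)) ⊎ (10 * numEdges H ≤ 10 * degree H v + 11 * (k ∸ l))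
lemma4p4 k l n H uniform intersecting 20μ≤m v =
  map₂ other-part-small
    (unbalanced-split μ d b (subst (20 * μ ≤_) (sym d+b≡m) 20μ≤m)
                            (subst (λ m → d * b ≤ m * μ) (sym d+b≡m) (containing*avoiding≤length*[k∸l] v uniform intersecting)))
  where
  open ≤-Reasoning
  μ = k ∸ l
  d = degree H v
  b = length (avoiding v (edges H))
  m = numEdges H
  d+b≡m : d + b ≡ m
  d+b≡m = length-filter+length-filter-∁ (v ∈?_) (edges H)
  other-part-small : 10 * b ≤ 11 * μ → 10 * m ≤ 10 * d + 11 * μ
  other-part-small 10b≤11μ = begin
    10 * m            ≡⟨ cong (10 *_) d+b≡m ⟨
    10 * (d + b)      ≡⟨ *-distribˡ-+ 10 d b ⟩
    10 * d + 10 * b   ≤⟨ +-monoʳ-≤ (10 * d) 10b≤11μ ⟩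
    10 * d + 11 * μ   ∎
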